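{- Let $N\ge 1$, let $d\in\mathbb{R}$, let $P$ be a real $N\times N$ matrix, and let $V\in\mathbb{R}^N$. For $k\in\{1,\dots,N\}$ let $J_k$ be the $N\times N$ matrix whose only nonzero entry is $(J_k)_{kk}=1$, and let $I_d$ be the $N\times N$ identity matrix. Let $(i_n)_{n\ge 1}$ be any sequence with values in $\{1,\dots,N\}$. Define vectors $F_n,H_n\in\mathbb{R}^N$ by $$F_0=(1-d)V,\qquad F_n=(I_d-J_{i_n}+dPJ_{i_n})F_{n-1}\ (n\ge 1),$$ $$H_n=\sum_{k=1}^n J_{i_k}F_{k-1}\ (n\ge 0,\ \text{so } H_0=0).$$ Then for every $n\ge 0$, $$H_n+F_n=F_0+dPH_n.$$
   Context: In the paper's setting, $P$ is a nonnegative $N\times N$ matrix whose columns each sum to one, $V$ is a nonnegative vector with entries summing to one, and $d$ is a damping factor in $(0,1)$; the identity stated here is purely algebraic. $F_n$ is called the fluid vector and $H_n$ the history vector. -}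

module Defs where

open import Level using (Level)
open import Algebra.Bundles using (CommutativeRing)
open import Data.Nat using (ℕ; zero; suc)
open import Data.Fin using (Fin; zero; suc; _≟_)
open import Relation.Nullary using (yes; no)

-- Linear algebra over an arbitrary commutative ring R (the paper's ℝ is an instance).
module LinAlg {c ℓ : Level} (R : CommutativeRing c ℓ) where
  open CommutativeRing R hiding (zero)

  Vector : ℕ → Set c
  Vector N = Fin N → Carrier

  Matrix : ℕ → Set c
  Matrix N = Fin N → Fin N → Carrier

  sumFin : ∀ {n} → (Fin n → Carrier) → Carrier
  sumFin {zero}  f = 0#
  sumFin {suc n} f = f zero + sumFin (λ j → f (suc j))

  _≈ᵥ_ : ∀ {N} → Vector N → Vector N → Set ℓ
  u ≈ᵥ v = ∀ i → u i ≈ v i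

  zeroV : ∀ {N} → Vector N
  zeroV _ = 0#

  _+ᵥ_ : ∀ {N} → Vector N → Vector N → Vector N
  (u +ᵥ v) i = u i + v i

  _·ᵥ_ : ∀ {N} → Carrier → Vector N → Vector N
  (a ·ᵥ v) i = a * v i

  _+ₘ_ : ∀ {N} → Matrix N → Matrix N → Matrix N
  (A +ₘ B) i j = A i j + B i j

  _-ₘ_ : ∀ {N} → Matrix N → Matrix N → Matrix N
  (A -ₘ B) i j = A i j - B i j

  _·ₘ_ : ∀ {N} → Carrier → Matrix N → Matrix N
  (a ·ₘ A) i j = a * A i j

  _*ₘ_ : ∀ {N} → Matrix N → Matrix N → Matrix N
  (A *ₘ B) i j = sumFin (λ k → A i k * B k j)

  _*ᵥ_ : ∀ {N} → Matrix N → Vector N → Vector N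
  (A *ᵥ v) i = sumFin (λ k → A i k * v k)

  Id : ∀ {N} → Matrix N
  Id i j with i ≟ j
  ... | yes _ = 1#
  ... | no  _ = 0#

  J : ∀ {N} → Fin N → Matrix N
  J k i j with i ≟ k | j ≟ k
  ... | yes _ | yes _ = 1#
  ... | _     | _     = 0#

  -- fluid vector: F_0 = (1-d)V, F_n = (I - J_{i_n} + d P J_{i_n}) F_{n-1}.
  -- The sequence (i_n)_{n≥1} is a function ℕ → Fin N; its value at 0 is unused.
  F : ∀ {N} → Carrier → Matrix N → Vector N → (ℕ → Fin N) → ℕ → Vector N
  F d P V seq zero    = (1# - d) ·ᵥ V
  F d P V seq (suc n) =
    ((Id -ₘ J (seq (suc n))) +ₘ (d ·ₘ (P *ₘ J (seq (suc n))))) *ᵥ F d P V seq n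

  H : ∀ {N} → Carrier → Matrix N → Vector N → (ℕ → Fin N) → ℕ → Vector N
  H d P V seq zero    = zeroV
  H d P V seq (suc n) = H d P V seq n +ᵥ (J (seq (suc n)) *ᵥ F d P V seq n)

-- Let K be the matrix J_{i_{n+1}} and g := K F_n the part of the fluid that is
-- removed from F_n at step n+1. The history gains exactly g, while the fluid loses
-- g and receives d P g, so both sides of the identity grow by d P g; together with
-- H_0 = 0 this gives the claim by induction on n. No property of J_k is used, so
-- the identity holds for any sequence of matrices in place of the J_{i_n}.
module Submission where

open import Defs
open import Level using (Level)
open import Algebra.Bundles using (CommutativeRing)
open import Data.Nat using (ℕ; _≤_; zero; suc)
open import Data.Fin using (Fin; zero; suc; _≟_)
open import Relation.Nullary using (yes; no)
open import Relation.Binary.PropositionalEquality as ≡ using (_≡_)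
import Relation.Binary.Reasoning.Setoid as SetoidReasoning

module FluidHistory {c ℓ : Level} (R : CommutativeRing c ℓ) where
  open CommutativeRing R hiding (zero)
  open LinAlg R
  open SetoidReasoning setoid
  open import Algebra.Properties.Semiring.Sum semiring
    using (sum; sum-cong-≋; ∑-distrib-+; ∑-comm; *-distribˡ-sum)
  open import Algebra.Properties.Ring ring using (-1*x≈-x; -‿distribˡ-*)
  open import Algebra.Properties.CommutativeSemigroup +-commutativeSemigroup
    using (interchange)
  open import Algebra.Properties.CommutativeSemigroup *-commutativeSemigroup
    using (x∙yz≈y∙zx)

  sumFin≡sum : ∀ {n} → sumFin {n} ≡ sum {n}
  sumFin≡sum {zero}  = ≡.refl
  sumFin≡sum {suc n} = ≡.cong (λ s f → f zero + s (λ j → f (suc j))) sumFin≡sum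

  sumFin-cong : ∀ {n} {f g : Vector n} → f ≈ᵥ g → sumFin f ≈ sumFin g
  sumFin-cong {n} rewrite sumFin≡sum {n} = sum-cong-≋

  sumFin-+ : ∀ {n} (f g : Vector n) → sumFin (f +ᵥ g) ≈ sumFin f + sumFin g
  sumFin-+ {n} f g rewrite sumFin≡sum {n} = ∑-distrib-+ f g

  *-distribˡ-sumFin : ∀ {n} a (f : Vector n) → a * sumFin f ≈ sumFin (a ·ᵥ f)
  *-distribˡ-sumFin {n} a f rewrite sumFin≡sum {n} = *-distribˡ-sum a f

  sumFin-comm : ∀ {m n} (f : Fin m → Fin n → Carrier) →
    sumFin (λ i → sumFin (f i)) ≈ sumFin (λ j → sumFin (λ i → f i j))
  sumFin-comm {m} {n} f rewrite sumFin≡sum {m} | sumFin≡sum {n} = ∑-comm f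

  sumFin-neg : ∀ {n} (f : Vector n) → sumFin (λ i → - f i) ≈ - sumFin f
  sumFin-neg f = begin
    sumFin (λ i → - f i)       ≈⟨ sumFin-cong (λ i → -1*x≈-x (f i)) ⟨
    sumFin ((- 1#) ·ᵥ f)       ≈⟨ *-distribˡ-sumFin (- 1#) f ⟨
    - 1# * sumFin f            ≈⟨ -1*x≈-x (sumFin f) ⟩
    - sumFin f                 ∎

  sumFin-zero : ∀ n → sumFin {n} zeroV ≈ 0#
  sumFin-zero zero    = refl
  sumFin-zero (suc n) = trans (+-identityˡ _) (sumFin-zero n)

  *ᵥ-zeroʳ : ∀ {n} (A : Matrix n) → (A *ᵥ zeroV) ≈ᵥ zeroV
  *ᵥ-zeroʳ {n} A i = trans (sumFin-cong (λ k → zeroʳ (A i k))) (sumFin-zero n)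

  *ᵥ-distribˡ-+ᵥ : ∀ {n} (A : Matrix n) (u w : Vector n) →
    (A *ᵥ (u +ᵥ w)) ≈ᵥ ((A *ᵥ u) +ᵥ (A *ᵥ w))
  *ᵥ-distribˡ-+ᵥ {n} A u w i =
    trans (sumFin-cong (λ k → distribˡ (A i k) (u k) (w k))) (sumFin-+ {n} _ _)

  +ₘ-*ᵥ-distrib : ∀ {n} (A B : Matrix n) (v : Vector n) →
    ((A +ₘ B) *ᵥ v) ≈ᵥ ((A *ᵥ v) +ᵥ (B *ᵥ v))
  +ₘ-*ᵥ-distrib {n} A B v i =
    trans (sumFin-cong (λ k → distribʳ (v k) (A i k) (B i k))) (sumFin-+ {n} _ _)

  -ₘ-*ᵥ-distrib : ∀ {n} (A B : Matrix n) (v : Vector n) i →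
    ((A -ₘ B) *ᵥ v) i ≈ (A *ᵥ v) i - (B *ᵥ v) i
  -ₘ-*ᵥ-distrib {n} A B v i = begin
    sumFin (λ k → (A i k - B i k) * v k)
      ≈⟨ sumFin-cong (λ k → trans (distribʳ (v k) (A i k) (- B i k))
                                   (+-congˡ (sym (-‿distribˡ-* (B i k) (v k))))) ⟩
    sumFin (λ k → A i k * v k + - (B i k * v k))
      ≈⟨ sumFin-+ {n} _ _ ⟩
    (A *ᵥ v) i + sumFin (λ k → - (B i k * v k))
      ≈⟨ +-congˡ (sumFin-neg {n} _) ⟩
    (A *ᵥ v) i - (B *ᵥ v) i ∎

  ·ₘ-*ᵥ-assoc : ∀ {n} a (A : Matrix n) (v : Vector n) i →
    ((a ·ₘ A) *ᵥ v) i ≈ a * (A *ᵥ v) i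
  ·ₘ-*ᵥ-assoc {n} a A v i =
    trans (sumFin-cong (λ k → *-assoc a (A i k) (v k))) (sym (*-distribˡ-sumFin {n} a _))

  *ₘ-*ᵥ-assoc : ∀ {n} (A B : Matrix n) (v : Vector n) i →
    ((A *ₘ B) *ᵥ v) i ≈ (A *ᵥ (B *ᵥ v)) i
  *ₘ-*ᵥ-assoc {n} A B v i = begin
    sumFin (λ k → sumFin (λ l → A i l * B l k) * v k)
      ≈⟨ sumFin-cong (λ k → trans (*-comm _ (v k)) (*-distribˡ-sumFin {n} (v k) _)) ⟩
    sumFin (λ k → sumFin (λ l → v k * (A i l * B l k)))
      ≈⟨ sumFin-cong (λ k → sumFin-cong (λ l → x∙yz≈y∙zx (v k) (A i l) (B l k))) ⟩
    sumFin (λ k → sumFin (λ l → A i l * (B l k * v k)))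
      ≈⟨ sumFin-comm {n} {n} _ ⟩
    sumFin (λ l → sumFin (λ k → A i l * (B l k * v k)))
      ≈⟨ sumFin-cong (λ l → *-distribˡ-sumFin {n} (A i l) _) ⟨
    (A *ᵥ (B *ᵥ v)) i ∎

  Id-suc : ∀ {n} (i j : Fin n) → Id (suc i) (suc j) ≡ Id i j
  Id-suc i j with i ≟ j
  ... | yes _ = ≡.refl
  ... | no  _ = ≡.refl

  Id-*ᵥ : ∀ {n} (v : Vector n) → (Id *ᵥ v) ≈ᵥ v
  Id-*ᵥ {suc n} v zero = begin
    1# * v zero + sumFin (λ j → 0# * v (suc j))
      ≈⟨ +-cong (*-identityˡ (v zero)) (sumFin-cong (λ j → zeroˡ (v (suc j)))) ⟩
    v zero + sumFin {n} zeroV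
      ≈⟨ +-congˡ (sumFin-zero n) ⟩
    v zero + 0#
      ≈⟨ +-identityʳ (v zero) ⟩
    v zero ∎
  Id-*ᵥ {suc n} v (suc i) = begin
    Id (suc i) zero * v zero + sumFin (λ j → Id (suc i) (suc j) * v (suc j))
      ≈⟨ +-cong (zeroˡ (v zero)) (sumFin-cong (λ j → reflexive (≡.cong (_* v (suc j)) (Id-suc i j)))) ⟩
    0# + (Id *ᵥ (λ j → v (suc j))) i
      ≈⟨ +-identityˡ _ ⟩
    (Id *ᵥ (λ j → v (suc j))) i
      ≈⟨ Id-*ᵥ (λ j → v (suc j)) i ⟩
    v (suc i) ∎

  fluid-step : ∀ {n} d (P K : Matrix n) (v : Vector n) i →
    (((Id -ₘ K) +ₘ (d ·ₘ (P *ₘ K))) *ᵥ v) i ≈ (v i - (K *ᵥ v) i) + ((d ·ₘ P) *ᵥ (K *ᵥ v)) i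
  fluid-step d P K v i = begin
    (((Id -ₘ K) +ₘ (d ·ₘ (P *ₘ K))) *ᵥ v) i
      ≈⟨ +ₘ-*ᵥ-distrib (Id -ₘ K) (d ·ₘ (P *ₘ K)) v i ⟩
    ((Id -ₘ K) *ᵥ v) i + ((d ·ₘ (P *ₘ K)) *ᵥ v) i
      ≈⟨ +-cong (-ₘ-*ᵥ-distrib Id K v i) (·ₘ-*ᵥ-assoc d (P *ₘ K) v i) ⟩
    ((Id *ᵥ v) i - (K *ᵥ v) i) + d * ((P *ₘ K) *ᵥ v) i
      ≈⟨ +-cong (+-congʳ (Id-*ᵥ v i)) (*-congˡ (*ₘ-*ᵥ-assoc P K v i)) ⟩
    (v i - (K *ᵥ v) i) + d * (P *ᵥ (K *ᵥ v)) i
      ≈⟨ +-congˡ (·ₘ-*ᵥ-assoc d P (K *ᵥ v) i) ⟨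
    (v i - (K *ᵥ v) i) + ((d ·ₘ P) *ᵥ (K *ᵥ v)) i ∎

  x+y+[z-y+w]≈x+z+w : ∀ x y z w → (x + y) + ((z - y) + w) ≈ (x + z) + w
  x+y+[z-y+w]≈x+z+w x y z w = begin
    (x + y) + ((z - y) + w)   ≈⟨ +-assoc (x + y) (z - y) w ⟨
    ((x + y) + (z - y)) + w   ≈⟨ +-congʳ (interchange x y z (- y)) ⟩
    ((x + z) + (y - y)) + w   ≈⟨ +-congʳ (+-congˡ (-‿inverseʳ y)) ⟩
    ((x + z) + 0#) + w        ≈⟨ +-congʳ (+-identityʳ (x + z)) ⟩
    (x + z) + w               ∎

  history+fluid : ∀ {N} d (P : Matrix N) (V : Vector N) (seq : ℕ → Fin N) n →
    (H d P V seq n +ᵥ F d P V seq n) ≈ᵥ (F d P V seq 0 +ᵥ ((d ·ₘ P) *ᵥ H d P V seq n))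
  history+fluid d P V seq zero i = begin
    0# + F₀ i                       ≈⟨ +-identityˡ (F₀ i) ⟩
    F₀ i                            ≈⟨ +-identityʳ (F₀ i) ⟨
    F₀ i + 0#                       ≈⟨ +-congˡ (*ᵥ-zeroʳ (d ·ₘ P) i) ⟨
    F₀ i + ((d ·ₘ P) *ᵥ zeroV) i    ∎
    where F₀ = F d P V seq 0
  history+fluid d P V seq (suc n) i = begin
    (h i + g i) + (((Id -ₘ K) +ₘ (d ·ₘ (P *ₘ K))) *ᵥ f) i
      ≈⟨ +-congˡ (fluid-step d P K f i) ⟩
    (h i + g i) + ((f i - g i) + ((d ·ₘ P) *ᵥ g) i)
      ≈⟨ x+y+[z-y+w]≈x+z+w (h i) (g i) (f i) _ ⟩
    (h i + f i) + ((d ·ₘ P) *ᵥ g) i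
      ≈⟨ +-congʳ (history+fluid d P V seq n i) ⟩
    (F₀ i + ((d ·ₘ P) *ᵥ h) i) + ((d ·ₘ P) *ᵥ g) i
      ≈⟨ +-assoc (F₀ i) _ _ ⟩
    F₀ i + (((d ·ₘ P) *ᵥ h) i + ((d ·ₘ P) *ᵥ g) i)
      ≈⟨ +-congˡ (*ᵥ-distribˡ-+ᵥ (d ·ₘ P) h g i) ⟨
    F₀ i + ((d ·ₘ P) *ᵥ (h +ᵥ g)) i ∎
    where
    F₀ = F d P V seq 0
    h = H d P V seq n
    f = F d P V seq n
    K = J (seq (suc n))
    g = K *ᵥ f

theorem1 : {c ℓ : Level} (R : CommutativeRing c ℓ) →
    let open CommutativeRing R using (Carrier) in
    let open LinAlg R in
    (N : ℕ) → 1 ≤ N → (d : Carrier) (P : Matrix N) (V : Vector N)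
    (seq : ℕ → Fin N) (n : ℕ) →
    (H d P V seq n +ᵥ F d P V seq n) ≈ᵥ (F d P V seq 0 +ᵥ ((d ·ₘ P) *ᵥ H d P V seq n))
theorem1 R N _ = FluidHistory.history+fluid R
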